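{- Let $T$ be a trigraph in the class $\mathcal{F}$ that admits no balanced skew-partition and contains no antihole of length six. If $T$ is unfavorable, then either $T$ is complete or $|V(T)|\le 5$.
   Context: A trigraph $T$ consists of a finite set $V(T)$ and a map $\theta:\binom{V(T)}{2}\to\{ -1,0,1\}$. Distinct $u,v$ are strongly adjacent if $\theta(uv)=1$, strongly antiadjacent if $\theta(uv)=-1$, semiadjacent (a switchable pair) if $\theta(uv)=0$; adjacent if $\theta(uv)\in\{0,1\}$, antiadjacent if $\theta(uv)\in\{0,-1\}$. $N(v)$ is the set of vertices adjacent to $v$. The complement $\overline T$ has adjacency function $-\theta$. $T|X$ is the restriction to $X$, $T\setminus X=T|(V(T)\setminus X)$; $T$ contains $H$ if $H$ is isomorphic to some $T|X$. A clique is a set of pairwise adjacent vertices; $T$ is complete if $V(T)$ is a clique. A path is a sequence $p_1,\dots,p_k$ of distinct vertices with $p_i,p_j$ adjacent when $|i-j|=1$ and antiadjacent when $|i-j|>1$; its length is $k-1$. A hole is a sequence $h_1,\dots,h_k$ ($k\ge 5$) of distinct vertices with cyclically consecutive vertices adjacent and all other pairs antiadjacent; an antipath/antihole is an induced subtrigraph whose complement is a path/hole in $\overline T$; lengths of holes/antiholes are their numbers of vertices. $T$ is Berge if it contains no odd hole and no odd antihole. A set $X$ is connected if the graph on $X$ whose edges are the adjacent pairs is connected, and anticonnected if the graph on $X$ whose edges are the antiadjacent pairs is connected. A skew-partition is a partition $(A,B)$ of $V(T)$ with $A$ not connected and $B$ not anticonnected; it is balanced if there is no odd path of length $>1$ with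 both ends in $B$ and interior in $A$, and no odd antipath of length $>1$ with both ends in $A$ and interior in $B$. $\Sigma(T)$ is the graph on $V(T)$ whose edges are the switchable pairs; a switchable component is a connected component of $\Sigma(T)$ with at least two vertices. $\mathcal F$ is the class of Berge trigraphs $T$ such that: (1) $T$ has at most one switchable component, and it has at most two edges; (2) if it has exactly one edge $xy$, then $N(x)\cap N(y)=\emptyset$ (the component is called small); (3) if it has two edges $vx,vy$, then $v$ is strongly antiadjacent to every vertex outside $\{v,x,y\}$, $x$ is strongly antiadjacent to $y$, and $N(x)\cap N(y)=\{v\}$ (called light). Let $D$ be the vertex set of the switchable component ($D=\emptyset$ if there is none). A pair $\{u,v\}$ is disjoint from the switchable component if $\{u,v\}\cap D=\emptyset$. A trigraph $T\in\mathcal F$ is favorable if (1) $|V(T)|\ge 5$; (2) $T$ has a pair of strongly antiadjacent vertices disjoint from $D$; (3) if $D=\{x,y\}$ is small, then at least one of $T\setminus(D\cup N(x))$, $T\setminus(D\cup N(y))$ is not a clique. Otherwise $T$ is unfavorable. -}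

module Defs where

open import Data.Nat using (ℕ; zero; suc; _*_; _<_; _≤_)
open import Data.Fin using (Fin; toℕ)
open import Data.Fin.Subset using (Subset; _∈_; _∉_; ∁)
open import Data.Product using (_×_; ∃-syntax; Σ)
open import Data.Sum using (_⊎_)
open import Relation.Nullary using (¬_)
open import Relation.Binary.PropositionalEquality using (_≡_; _≢_; cong)
open import Function.Definitions using (Injective)

data Val : Set where
  plus1  : Val
  zero0  : Val
  minus1 : Val

negV : Val → Val
negV plus1  = minus1
negV zero0  = zero0
negV minus1 = plus1

-- Trigraphs on vertex set Fin n.  θ is only meaningful on distinct pairs
-- (all notions below only use θ u v for u ≢ v); it is symmetric.

record Trigraph (n : ℕ) : Set where
  field
    θ   : Fin n → Fin n → Val
    sym : ∀ u v → θ u v ≡ θ v u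
open Trigraph public

complement : ∀ {n} → Trigraph n → Trigraph n
complement T = record { θ = λ u v → negV (θ T u v) ; sym = λ u v → cong negV (sym T u v) }

module _ {n : ℕ} (T : Trigraph n) where

  StronglyAdj : Fin n → Fin n → Set
  StronglyAdj u v = u ≢ v × θ T u v ≡ plus1

  StronglyAnti : Fin n → Fin n → Set
  StronglyAnti u v = u ≢ v × θ T u v ≡ minus1

  Semi : Fin n → Fin n → Set
  Semi u v = u ≢ v × θ T u v ≡ zero0

  Adj : Fin n → Fin n → Set
  Adj u v = u ≢ v × (θ T u v ≡ zero0 ⊎ θ T u v ≡ plus1)

  Anti : Fin n → Fin n → Set
  Anti u v = u ≢ v × (θ T u v ≡ zero0 ⊎ θ T u v ≡ minus1)

  Clique : (Fin n → Set) → Set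
  Clique X = ∀ u v → X u → X v → u ≢ v → Adj u v

  Complete : Set
  Complete = ∀ u v → u ≢ v → Adj u v

  -- Paths: p₀,…,p_l distinct, consecutive adjacent, others antiadjacent.
  -- (Adj/Anti are symmetric, so ordered index pairs suffice.)  Length l.

  IsPath : (l : ℕ) → (Fin (suc l) → Fin n) → Set
  IsPath l p =
    Injective _≡_ _≡_ p
    × (∀ i j → toℕ j ≡ suc (toℕ i) → Adj (p i) (p j))
    × (∀ i j → suc (toℕ i) < toℕ j → Anti (p i) (p j))

  CycConsec : (k : ℕ) → Fin k → Fin k → Set
  CycConsec k i j = toℕ j ≡ suc (toℕ i) ⊎ (toℕ i ≡ 0 × suc (toℕ j) ≡ k)

  IsHole : (k : ℕ) → (Fin k → Fin n) → Set
  IsHole k h =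
    5 ≤ k
    × Injective _≡_ _≡_ h
    × (∀ i j → toℕ i < toℕ j → CycConsec k i j → Adj (h i) (h j))
    × (∀ i j → toℕ i < toℕ j → ¬ CycConsec k i j → Anti (h i) (h j))

  data Reach (X : Subset n) (u : Fin n) : Fin n → Set where
    here : u ∈ X → Reach X u u
    step : ∀ {w v} → Reach X u w → Adj w v → v ∈ X → Reach X u v

  Connected : Subset n → Set
  Connected X = ∀ u v → u ∈ X → v ∈ X → Reach X u v

module _ {n : ℕ} (T : Trigraph n) where

  IsAntipath : (l : ℕ) → (Fin (suc l) → Fin n) → Set
  IsAntipath = IsPath (complement T)

  IsAntihole : (k : ℕ) → (Fin k → Fin n) → Set
  IsAntihole = IsHole (complement T)

  Anticonnected : Subset n → Set
  Anticonnected = Connected (complement T)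

Odd : ℕ → Set
Odd k = ∃[ m ] k ≡ suc (m * 2)

module _ {n : ℕ} (T : Trigraph n) where

  Berge : Set
  Berge = (¬ (∃[ k ] Σ (Fin k → Fin n) λ h → (Odd k × IsHole T k h)))
        × (¬ (∃[ k ] Σ (Fin k → Fin n) λ h → (Odd k × IsAntihole T k h)))

  ContainsAntihole6 : Set
  ContainsAntihole6 = Σ (Fin 6 → Fin n) λ h → IsAntihole T 6 h

  -- Skew-partitions.  A partition (A , B) of V(T) is given by A ⊆ V(T),
  -- with B = ∁ A.

  IsSkewPartition : Subset n → Set
  IsSkewPartition A = ¬ Connected T A × ¬ Anticonnected T (∁ A)

  BadPath : Subset n → Set
  BadPath A = Σ ℕ λ l → Σ (Fin (suc l) → Fin n) λ p →
    Odd l × 1 < l × IsPath T l p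
    × (∀ i → (toℕ i ≡ 0 ⊎ toℕ i ≡ l) → p i ∈ ∁ A)
    × (∀ i → 0 < toℕ i → toℕ i < l → p i ∈ A)

  BadAntipath : Subset n → Set
  BadAntipath A = Σ ℕ λ l → Σ (Fin (suc l) → Fin n) λ p →
    Odd l × 1 < l × IsAntipath T l p
    × (∀ i → (toℕ i ≡ 0 ⊎ toℕ i ≡ l) → p i ∈ A)
    × (∀ i → 0 < toℕ i → toℕ i < l → p i ∈ ∁ A)

  Balanced : Subset n → Set
  Balanced A = ¬ BadPath A × ¬ BadAntipath A

  HasBalancedSkewPartition : Set
  HasBalancedSkewPartition = ∃[ A ] (IsSkewPartition A × Balanced A)

  -- Since every edge of Σ(T) lies
  -- in a switchable component, condition (1) of 𝓕 (at most one switchable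
  -- component, with at most two edges) says: the set of switchable pairs
  -- is empty, a single pair {x,y}, or two pairs {v,x},{v,y} (two edges in
  -- one component share a vertex).

  OnlySwitchable1 : Fin n → Fin n → Set
  OnlySwitchable1 x y = ∀ u v → Semi T u v → (u ≡ x × v ≡ y) ⊎ (u ≡ y × v ≡ x)

  OnlySwitchable2 : Fin n → Fin n → Fin n → Set
  OnlySwitchable2 c x y = ∀ u v → Semi T u v →
    (u ≡ c × v ≡ x) ⊎ (u ≡ x × v ≡ c) ⊎ (u ≡ c × v ≡ y) ⊎ (u ≡ y × v ≡ c)

  NoSwitchable : Set
  NoSwitchable = ∀ u v → ¬ Semi T u v

  SmallComp : Fin n → Fin n → Set
  SmallComp x y = Semi T x y × OnlySwitchable1 x y
                × (∀ w → ¬ (Adj T x w × Adj T y w))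

  LightComp : Fin n → Fin n → Fin n → Set
  LightComp c x y = Semi T c x × Semi T c y × x ≢ y × OnlySwitchable2 c x y
                  × (∀ w → w ≢ c → w ≢ x → w ≢ y → StronglyAnti T c w)
                  × StronglyAnti T x y
                  × (∀ w → (Adj T x w × Adj T y w) → w ≡ c)

  InF : Set
  InF = Berge
      × (NoSwitchable
         ⊎ (∃[ x ] ∃[ y ] SmallComp x y)
         ⊎ (∃[ c ] ∃[ x ] ∃[ y ] LightComp c x y))

  -- D: vertices of the switchable component (= vertices in some
  -- switchable pair, as there is at most one switchable component)
  InD : Fin n → Set
  InD w = ∃[ u ] Semi T w u

  Favorable : Set
  Favorable =
      5 ≤ n
    × (∃[ u ] ∃[ v ] (StronglyAnti T u v × ¬ InD u × ¬ InD v))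
    × (∀ x y → SmallComp x y →
         (¬ Clique T (λ w → ¬ InD w × ¬ Adj T x w))
       ⊎ (¬ Clique T (λ w → ¬ InD w × ¬ Adj T y w)))

  Unfavorable : Set
  Unfavorable = ¬ Favorable

-- Suppose n ≥ 6 and let D be the switchable component. A strongly antiadjacent
-- pair outside D makes T favorable unless D is small, so for D = ∅ the trigraph
-- is complete, and for D ≠ ∅ we reach a contradiction. Every skew partition in
-- the argument has a strong clique or a strongly stable pair as one side, which
-- makes it balanced.
-- If V ∖ D is a strong clique, three of its vertices contain one without
-- neighbours in D, or two with a common neighbour in D; either way a balanced
-- skew partition (or, for light D, a 5-hole through D) appears.
-- Otherwise D = {x, y} is small and unfavorability makes V ∖ (D ∪ N(x)) and
-- V ∖ (D ∪ N(y)) cliques. Then V ∖ D is covered by the cliques N(x) ∖ D and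
-- N(y) ∖ D (a vertex in neither closes a 5-hole), whose neighbourhoods in each
-- other are nested (a crossing gives a 6-antihole). A vertex with extremal
-- neighbourhood yields a balanced skew partition unless both cliques are single
-- vertices, contradicting n ≥ 6.

module Submission where

open import Defs
open import Data.Bool using (Bool; true; false)
open import Data.Empty using (⊥; ⊥-elim)
open import Data.Fin using (Fin; zero; suc; toℕ; fromℕ; #_)
open import Data.Fin.Properties using (_≟_; any?; all?; ¬∀⟶∃¬; <-cmp; toℕ-fromℕ; injective⇒≤)
open import Data.Fin.Subset using (Subset; _∈_; _∉_; ∁)
open import Data.Fin.Subset.Properties using (x∈∁p⇒x∉p; x∉p⇒x∈∁p)
open import Data.List using (List; []; _∷_; allFin)
open import Data.List.Membership.Propositional using () renaming (_∈_ to _∈ₗ_)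
open import Data.List.Membership.Propositional.Properties using (∈-allFin)
open import Data.List.Relation.Unary.Any using (here; there)
open import Data.Nat as ℕ using (ℕ; suc; _≤_; _<_; z≤n; s≤s; _≤?_)
open import Data.Nat.Properties using (≤-trans; <⇒≤; ≰⇒>; <⇒≱; m≤m+n)
open import Data.Product using (∃; ∃₂; _×_; _,_; proj₁; proj₂)
open import Data.Sum using (_⊎_; inj₁; inj₂; [_,_]; map₂; swap)
open import Data.Vec using (_∷_; []; lookup; tabulate)
open import Data.Vec.Properties using (lookup∘tabulate; []=⇒lookup; lookup⇒[]=)
open import Function using (_∘_)
open import Function.Definitions using (Injective)
open import Relation.Binary.Definitions using (DecidableEquality; Reflexive; Transitive; tri<; tri≈; tri>)
open import Relation.Binary.PropositionalEquality as ≡ using (_≡_; _≢_; refl; subst; ≢-sym)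
open import Relation.Nullary using (¬_; Dec; yes; no; does)
open import Relation.Nullary.Decidable
  using (¬?; _×-dec_; _⊎-dec_; dec-true; dec-false; decidable-stable; ¬¬-excluded-middle)
open import Relation.Unary using (Decidable)

∃-avoiding : ∀ {k n} → k < n → (f : Fin k → Fin n) → ∃ λ v → ∀ j → v ≢ f j
∃-avoiding {k} {n} k<n f with any? (λ v → all? (λ j → ¬? (v ≟ f j)))
... | yes found = found
... | no none = ⊥-elim (<⇒≱ k<n (injective⇒≤ preimage-injective))
  where
  hit : ∀ v → ∃ λ j → v ≡ f j
  hit v with ¬∀⟶∃¬ k _ (λ j → ¬? (v ≟ f j)) (λ avoids → none (v , avoids))
  ... | j , ¬¬v≡fj = j , decidable-stable (v ≟ f j) ¬¬v≡fj
  preimage-injective : Injective _≡_ _≡_ (λ v → proj₁ (hit v))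
  preimage-injective {v} {w} e = ≡.trans (proj₂ (hit v)) (≡.trans (≡.cong f e) (≡.sym (proj₂ (hit w))))

record Triple {n : ℕ} (O : Fin n → Set) : Set where
  field
    k₁ k₂ k₃ : Fin n
    k₁≢k₂ : k₁ ≢ k₂
    k₁≢k₃ : k₁ ≢ k₃
    k₂≢k₃ : k₂ ≢ k₃
    O₁ : O k₁
    O₂ : O k₂
    O₃ : O k₃

triple-avoiding : ∀ {n} → 5 < n → (a b c : Fin n) → ∀ {O}
  → (∀ {w} → w ≢ a → w ≢ b → w ≢ c → O w) → Triple O
triple-avoiding 5<n a b c outside
  with k₁ , h₁ ← ∃-avoiding (≤-trans (m≤m+n 4 2) 5<n) (lookup (a ∷ b ∷ c ∷ []))
  with k₂ , h₂ ← ∃-avoiding (≤-trans (m≤m+n 5 1) 5<n) (lookup (a ∷ b ∷ c ∷ k₁ ∷ []))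
  with k₃ , h₃ ← ∃-avoiding 5<n (lookup (a ∷ b ∷ c ∷ k₁ ∷ k₂ ∷ []))
  = record
  { k₁ = k₁ ; k₂ = k₂ ; k₃ = k₃
  ; k₁≢k₂ = ≢-sym (h₂ (# 3)) ; k₁≢k₃ = ≢-sym (h₃ (# 3)) ; k₂≢k₃ = ≢-sym (h₃ (# 4))
  ; O₁ = outside (h₁ (# 0)) (h₁ (# 1)) (h₁ (# 2))
  ; O₂ = outside (h₂ (# 0)) (h₂ (# 1)) (h₂ (# 2))
  ; O₃ = outside (h₃ (# 0)) (h₃ (# 1)) (h₃ (# 2))
  }

AtLeastTwo : ∀ {n} → (Fin n → Set) → Set
AtLeastTwo P = ∃₂ λ p q → p ≢ q × P p × P q

¬atLeastTwo : ∀ {n} {P : Fin n → Set} {s} → (∀ {a} → P a → a ≡ s) → ¬ AtLeastTwo P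
¬atLeastTwo only (p , q , p≢q , Pp , Pq) = p≢q (≡.trans (only Pp) (≡.sym (only Pq)))

TripleOutcome : ∀ {n} → (O A B C : Fin n → Set) → Set
TripleOutcome O A B C = (∃ λ m → O m × C m × AtLeastTwo (λ w → O w × w ≢ m))
                      ⊎ AtLeastTwo (λ w → O w × A w) ⊎ AtLeastTwo (λ w → O w × B w)

module _ {n : ℕ} {O A B C : Fin n → Set} (t : Triple O) (classify : ∀ {w} → O w → A w ⊎ B w ⊎ C w) where

  open Triple t

  triple-classify : TripleOutcome O A B C
  triple-classify with classify O₁ | classify O₂ | classify O₃
  ... | inj₂ (inj₂ C₁) | _ | _ = inj₁ (k₁ , O₁ , C₁ , k₂ , k₃ , k₂≢k₃ , (O₂ , ≢-sym k₁≢k₂) , (O₃ , ≢-sym k₁≢k₃))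
  ... | _ | inj₂ (inj₂ C₂) | _ = inj₁ (k₂ , O₂ , C₂ , k₁ , k₃ , k₁≢k₃ , (O₁ , k₁≢k₂) , (O₃ , ≢-sym k₂≢k₃))
  ... | _ | _ | inj₂ (inj₂ C₃) = inj₁ (k₃ , O₃ , C₃ , k₁ , k₂ , k₁≢k₂ , (O₁ , k₁≢k₃) , (O₂ , k₂≢k₃))
  ... | inj₁ A₁ | inj₁ A₂ | _ = inj₂ (inj₁ (k₁ , k₂ , k₁≢k₂ , (O₁ , A₁) , (O₂ , A₂)))
  ... | inj₁ A₁ | _ | inj₁ A₃ = inj₂ (inj₁ (k₁ , k₃ , k₁≢k₃ , (O₁ , A₁) , (O₃ , A₃)))
  ... | _ | inj₁ A₂ | inj₁ A₃ = inj₂ (inj₁ (k₂ , k₃ , k₂≢k₃ , (O₂ , A₂) , (O₃ , A₃)))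
  ... | inj₂ (inj₁ B₁) | inj₂ (inj₁ B₂) | _ = inj₂ (inj₂ (k₁ , k₂ , k₁≢k₂ , (O₁ , B₁) , (O₂ , B₂)))
  ... | inj₂ (inj₁ B₁) | _ | inj₂ (inj₁ B₃) = inj₂ (inj₂ (k₁ , k₃ , k₁≢k₃ , (O₁ , B₁) , (O₃ , B₃)))
  ... | _ | inj₂ (inj₁ B₂) | inj₂ (inj₁ B₃) = inj₂ (inj₂ (k₂ , k₃ , k₂≢k₃ , (O₂ , B₂) , (O₃ , B₃)))

module _ {A : Set} {_≼_ : A → A → Set} (≼-refl : Reflexive _≼_) (≼-trans : Transitive _≼_) {Q : A → Set}
         (≼-total : ∀ {a b} → Q a → Q b → ¬ ¬ (a ≼ b ⊎ b ≼ a)) where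

  ¬¬-minimum : (as : List A) → ∀ {a₀} → Q a₀ → ¬ ¬ (∃ λ s → Q s × ∀ {a} → a ∈ₗ as → Q a → s ≼ a)
  ¬¬-minimum [] Qa₀ k = k (_ , Qa₀ , λ ())
  ¬¬-minimum (a ∷ as) Qa₀ k = ¬¬-minimum as Qa₀ λ (s , Qs , minimal) → ¬¬-excluded-middle λ
    { (no ¬Qa) → k (s , Qs , λ { (here refl) Qa → ⊥-elim (¬Qa Qa) ; (there b∈) → minimal b∈ })
    ; (yes Qa) → ≼-total Qs Qa λ
        { (inj₁ s≼a) → k (s , Qs , λ { (here refl) _ → s≼a ; (there b∈) → minimal b∈ })
        ; (inj₂ a≼s) → k (a , Qa , λ { (here refl) _ → ≼-refl
                                     ; (there b∈) Qb → ≼-trans a≼s (minimal b∈ Qb) }) } }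

odd>1⇒≥3 : ∀ {l} → Odd l → 1 < l → ∃ λ k → l ≡ 3 ℕ.+ k
odd>1⇒≥3 {suc (suc (suc k))} _ _ = k , refl
odd>1⇒≥3 {suc (suc 0)} (suc m , ()) _
odd>1⇒≥3 {suc 0} _ (s≤s ())

_≟ᵥ_ : DecidableEquality Val
plus1  ≟ᵥ plus1  = yes refl
zero0  ≟ᵥ zero0  = yes refl
minus1 ≟ᵥ minus1 = yes refl
plus1  ≟ᵥ zero0  = no λ ()
plus1  ≟ᵥ minus1 = no λ ()
zero0  ≟ᵥ plus1  = no λ ()
zero0  ≟ᵥ minus1 = no λ ()
minus1 ≟ᵥ plus1  = no λ ()
minus1 ≟ᵥ zero0  = no λ ()

module Adjacency {n : ℕ} (T : Trigraph n) where

  private variable u v w : Fin n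

  adj-sym : Adj T u v → Adj T v u
  adj-sym {u} {v} (u≢v , a) = ≢-sym u≢v , subst (λ t → t ≡ zero0 ⊎ t ≡ plus1) (sym T u v) a

  semi-sym : Semi T u v → Semi T v u
  semi-sym {u} {v} (u≢v , s) = ≢-sym u≢v , ≡.trans (≡.sym (sym T u v)) s

  stronglyAnti-sym : StronglyAnti T u v → StronglyAnti T v u
  stronglyAnti-sym {u} {v} (u≢v , s) = ≢-sym u≢v , ≡.trans (≡.sym (sym T u v)) s

  semi⇒adj : Semi T u v → Adj T u v
  semi⇒adj (u≢v , s) = u≢v , inj₁ s

  strong⇒adj : u ≢ v → θ T u v ≡ plus1 → Adj T u v
  strong⇒adj u≢v s = u≢v , inj₂ s

  stronglyAnti⇒anti : StronglyAnti T u v → Anti T u v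
  stronglyAnti⇒anti (u≢v , s) = u≢v , inj₂ s

  plus1⇒¬anti : θ T u v ≡ plus1 → ¬ Anti T u v
  plus1⇒¬anti s (_ , a) rewrite s with a
  ... | inj₁ ()
  ... | inj₂ ()

  minus1⇒¬adj : θ T u v ≡ minus1 → ¬ Adj T u v
  minus1⇒¬adj s (_ , a) rewrite s with a
  ... | inj₁ ()
  ... | inj₂ ()

  stronglyAnti⇒¬adj : StronglyAnti T u v → ¬ Adj T u v
  stronglyAnti⇒¬adj (_ , s) = minus1⇒¬adj s

  ¬adj⇒minus1 : u ≢ v → ¬ Adj T u v → θ T u v ≡ minus1
  ¬adj⇒minus1 {u} {v} u≢v ¬uv with θ T u v
  ... | plus1  = ⊥-elim (¬uv (u≢v , inj₂ refl))
  ... | zero0  = ⊥-elim (¬uv (u≢v , inj₁ refl))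
  ... | minus1 = refl

  ¬adj⇒stronglyAnti : u ≢ v → ¬ Adj T u v → StronglyAnti T u v
  ¬adj⇒stronglyAnti u≢v ¬uv = u≢v , ¬adj⇒minus1 u≢v ¬uv

  ¬adj⇒anti : u ≢ v → ¬ Adj T u v → Anti T u v
  ¬adj⇒anti u≢v ¬uv = stronglyAnti⇒anti (¬adj⇒stronglyAnti u≢v ¬uv)

  adj? : ∀ u v → Dec (Adj T u v)
  adj? u v = ¬? (u ≟ v) ×-dec ((θ T u v ≟ᵥ zero0) ⊎-dec (θ T u v ≟ᵥ plus1))

  adjacentTo : ∀ x y w → Adj T x w ⊎ Adj T y w ⊎ (¬ Adj T x w × ¬ Adj T y w)
  adjacentTo x y w with adj? x w | adj? y w
  ... | yes xw | _ = inj₁ xw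
  ... | no _ | yes yw = inj₂ (inj₁ yw)
  ... | no ¬xw | no ¬yw = inj₂ (inj₂ (¬xw , ¬yw))

  inD? : Decidable (InD T)
  inD? w = any? λ u → ¬? (w ≟ u) ×-dec (θ T w u ≟ᵥ zero0)

  ¬inD⇒≢ : InD T v → ¬ InD T w → w ≢ v
  ¬inD⇒≢ inD ¬inD refl = ¬inD inD

  adj∧¬inD⇒strong : ¬ InD T u → Adj T u v → θ T u v ≡ plus1
  adj∧¬inD⇒strong ¬inD (u≢v , inj₁ s) = ⊥-elim (¬inD (_ , u≢v , s))
  adj∧¬inD⇒strong ¬inD (_ , inj₂ s) = s

  adj∧¬inD⇒strong′ : ¬ InD T v → Adj T u v → θ T u v ≡ plus1
  adj∧¬inD⇒strong′ {v} {u} ¬inD uv = ≡.trans (sym T u v) (adj∧¬inD⇒strong ¬inD (adj-sym uv))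

  adjᶜ⇒anti : Adj (complement T) u v → Anti T u v
  adjᶜ⇒anti {u} {v} (u≢v , a) = u≢v , flip (θ T u v) a
    where
    flip : ∀ t → negV t ≡ zero0 ⊎ negV t ≡ plus1 → t ≡ zero0 ⊎ t ≡ minus1
    flip zero0 _ = inj₁ refl
    flip minus1 _ = inj₂ refl
    flip plus1 (inj₁ ())
    flip plus1 (inj₂ ())

  antiᶜ⇒adj : Anti (complement T) u v → Adj T u v
  antiᶜ⇒adj {u} {v} (u≢v , a) = u≢v , flip (θ T u v) a
    where
    flip : ∀ t → negV t ≡ zero0 ⊎ negV t ≡ minus1 → t ≡ zero0 ⊎ t ≡ plus1
    flip zero0 _ = inj₁ refl
    flip plus1 _ = inj₂ refl
    flip minus1 (inj₁ ())
    flip minus1 (inj₂ ())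

  anti⇒adjᶜ : Anti T u v → Adj (complement T) u v
  anti⇒adjᶜ (u≢v , inj₁ s) = u≢v , inj₁ (≡.cong negV s)
  anti⇒adjᶜ (u≢v , inj₂ s) = u≢v , inj₂ (≡.cong negV s)

  adj⇒antiᶜ : Adj T u v → Anti (complement T) u v
  adj⇒antiᶜ (u≢v , inj₁ s) = u≢v , inj₁ (≡.cong negV s)
  adj⇒antiᶜ (u≢v , inj₂ s) = u≢v , inj₂ (≡.cong negV s)

  noStrongAntiPair⇒complete : (∀ u v → ¬ StronglyAnti T u v) → Complete T
  noStrongAntiPair⇒complete noPair u v u≢v with adj? u v
  ... | yes uv = uv
  ... | no ¬uv = ⊥-elim (noPair u v (¬adj⇒stronglyAnti u≢v ¬uv))

  NonNeighboursClique : Fin n → Set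
  NonNeighboursClique z = Clique T (λ w → ¬ InD T w × ¬ Adj T z w)

⟦_⟧ : ∀ {n} {X : Fin n → Set} → Decidable X → Subset n
⟦ X? ⟧ = tabulate λ w → does (X? w)

module _ {n : ℕ} {X : Fin n → Set} (X? : Decidable X) {w : Fin n} where

  ∈⟦⟧⁺ : X w → w ∈ ⟦ X? ⟧
  ∈⟦⟧⁺ x = lookup⇒[]= w ⟦ X? ⟧ (≡.trans (lookup∘tabulate _ w) (dec-true (X? w) x))

  ∈⟦⟧⁻ : w ∈ ⟦ X? ⟧ → X w
  ∈⟦⟧⁻ m with X? w | ≡.trans (≡.sym (lookup∘tabulate (λ v → does (X? v)) w)) ([]=⇒lookup m)
  ... | yes x | _ = x
  ... | no _  | ()

  ∈∁⟦⟧⁺ : ¬ X w → w ∈ ∁ ⟦ X? ⟧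
  ∈∁⟦⟧⁺ ¬x = x∉p⇒x∈∁p (λ m → ¬x (∈⟦⟧⁻ m))

  ∈∁⟦⟧⁻ : w ∈ ∁ ⟦ X? ⟧ → ¬ X w
  ∈∁⟦⟧⁻ m x = x∈∁p⇒x∉p m (∈⟦⟧⁺ x)

module Connectivity {n : ℕ} (T : Trigraph n) where

  AdjClosedIn : (Fin n → Set) → (Fin n → Set) → Set
  AdjClosedIn X S = ∀ {w z} → S w → Adj T w z → X z → S z

  isolated⇒closed : ∀ {X m} → (∀ z → Adj T m z → ¬ X z) → AdjClosedIn X (_≡ m)
  isolated⇒closed isolated refl mz Xz = ⊥-elim (isolated _ mz Xz)

  reach-closed : ∀ {A S u v} → AdjClosedIn (_∈ A) S → S u → Reach T A u v → S v
  reach-closed closed Su (here _) = Su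
  reach-closed closed Su (step r wv v∈A) = closed (reach-closed closed Su r) wv v∈A

  closed⇒¬connected : ∀ {A S s t} → AdjClosedIn (_∈ A) S → S s → s ∈ A → t ∈ A → ¬ S t → ¬ Connected T A
  closed⇒¬connected closed Ss s∈A t∈A ¬St connected = ¬St (reach-closed closed Ss (connected _ _ s∈A t∈A))

module Paths {n : ℕ} (T : Trigraph n) where

  path-ends-anti : ∀ {l p} → IsPath T l p → 1 < l → Anti T (p zero) (p (fromℕ l))
  path-ends-anti {l} (_ , _ , nonconsecutive) 1<l =
    nonconsecutive zero (fromℕ l) (subst (1 <_) (≡.sym (toℕ-fromℕ l)) 1<l)

  path-second-edge : ∀ {k p} → IsPath T (3 ℕ.+ k) p → Adj T (p (suc zero)) (p (suc (suc zero)))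
  path-second-edge (_ , consecutive , _) = consecutive (suc zero) (suc (suc zero)) refl

module SkewPartitions {n : ℕ} (T : Trigraph n) where

  open Adjacency T
  open Connectivity using (AdjClosedIn; isolated⇒closed; closed⇒¬connected)

  StrongClique : (Fin n → Set) → Set
  StrongClique X = ∀ u v → X u → X v → u ≢ v → θ T u v ≡ plus1

  StrongStable : (Fin n → Set) → Set
  StrongStable X = ∀ u v → X u → X v → u ≢ v → θ T u v ≡ minus1

  strongClique⇒¬badPath : ∀ {A} → StrongClique (_∈ ∁ A) → ¬ BadPath T A
  strongClique⇒¬badPath clique (l , p , _ , 1<l , path , ends , _) =
    plus1⇒¬anti (clique _ _ (ends zero (inj₁ refl)) (ends (fromℕ l) (inj₂ (toℕ-fromℕ l))) (proj₁ endsAnti))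
                endsAnti
    where endsAnti = Paths.path-ends-anti T path 1<l

  strongClique⇒¬badAntipath : ∀ {A} → StrongClique (_∈ ∁ A) → ¬ BadAntipath T A
  strongClique⇒¬badAntipath clique (l , p , odd , 1<l , antipath , _ , interior) with odd>1⇒≥3 odd 1<l
  ... | k , refl = plus1⇒¬anti (clique _ _ p₁∈ p₂∈ (proj₁ p₁p₂)) p₁p₂
    where
    p₁p₂ = adjᶜ⇒anti (Paths.path-second-edge (complement T) antipath)
    p₁∈ = interior (suc zero) (s≤s z≤n) (s≤s (s≤s z≤n))
    p₂∈ = interior (suc (suc zero)) (s≤s z≤n) (s≤s (s≤s (s≤s z≤n)))

  strongStable⇒¬badPath : ∀ {A} → StrongStable (_∈ A) → ¬ BadPath T A
  strongStable⇒¬badPath stable (l , p , odd , 1<l , path , _ , interior) with odd>1⇒≥3 odd 1<l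
  ... | k , refl = minus1⇒¬adj (stable _ _ p₁∈ p₂∈ (proj₁ p₁p₂)) p₁p₂
    where
    p₁p₂ = Paths.path-second-edge T path
    p₁∈ = interior (suc zero) (s≤s z≤n) (s≤s (s≤s z≤n))
    p₂∈ = interior (suc (suc zero)) (s≤s z≤n) (s≤s (s≤s (s≤s z≤n)))

  strongStable⇒¬badAntipath : ∀ {A} → StrongStable (_∈ A) → ¬ BadAntipath T A
  strongStable⇒¬badAntipath stable (l , p , _ , 1<l , antipath , ends , _) =
    minus1⇒¬adj (stable _ _ (ends zero (inj₁ refl)) (ends (fromℕ l) (inj₂ (toℕ-fromℕ l))) (proj₁ endsAdj))
                endsAdj
    where endsAdj = antiᶜ⇒adj (Paths.path-ends-anti (complement T) antipath 1<l)

  strongCliqueCutset⇒bsp : ∀ {X S s t} → Decidable X → StrongClique (λ w → ¬ X w) → AtLeastTwo (λ w → ¬ X w)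
    → AdjClosedIn T X S → S s → X s → X t → ¬ S t → HasBalancedSkewPartition T
  strongCliqueCutset⇒bsp X? clique (p , q , p≢q , ¬Xp , ¬Xq) closed Ss Xs Xt ¬St =
    ⟦ X? ⟧ , (disconnected , notAnticonnected)
           , strongClique⇒¬badPath clique′ , strongClique⇒¬badAntipath clique′
    where
    clique′ : StrongClique (_∈ ∁ ⟦ X? ⟧)
    clique′ u v u∈ v∈ = clique u v (∈∁⟦⟧⁻ X? u∈) (∈∁⟦⟧⁻ X? v∈)
    disconnected = closed⇒¬connected T (λ Sw wz z∈ → closed Sw wz (∈⟦⟧⁻ X? z∈))
                     Ss (∈⟦⟧⁺ X? Xs) (∈⟦⟧⁺ X? Xt) ¬St
    onlyAntineighbour : ∀ z → Adj (complement T) p z → z ∉ ∁ ⟦ X? ⟧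
    onlyAntineighbour z pz z∈ = plus1⇒¬anti (clique′ p z (∈∁⟦⟧⁺ X? ¬Xp) z∈ (proj₁ pz)) (adjᶜ⇒anti pz)
    notAnticonnected = closed⇒¬connected (complement T) (isolated⇒closed (complement T) onlyAntineighbour)
                         refl (∈∁⟦⟧⁺ X? ¬Xp) (∈∁⟦⟧⁺ X? ¬Xq) (≢-sym p≢q)

  strongAntiPair⇒bsp : ∀ {u v s t} → StronglyAnti T u v → s ≢ u → s ≢ v → t ≢ u → t ≢ v → t ≢ s
    → (∀ z → z ≢ u → z ≢ v → z ≢ s → θ T s z ≡ plus1) → HasBalancedSkewPartition T
  strongAntiPair⇒bsp {u} {v} {s} {t} uv s≢u s≢v t≢u t≢v t≢s dominating =
    ⟦ pair? ⟧ , (disconnected , notAnticonnected)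
              , strongStable⇒¬badPath stable , strongStable⇒¬badAntipath stable
    where
    pair? : Decidable (λ w → w ≡ u ⊎ w ≡ v)
    pair? w = (w ≟ u) ⊎-dec (w ≟ v)
    outside : ∀ {w} → w ≢ u → w ≢ v → w ∈ ∁ ⟦ pair? ⟧
    outside w≢u w≢v = ∈∁⟦⟧⁺ pair? λ { (inj₁ e) → w≢u e ; (inj₂ e) → w≢v e }
    stable : StrongStable (_∈ ⟦ pair? ⟧)
    stable a b a∈ b∈ a≢b with ∈⟦⟧⁻ pair? a∈ | ∈⟦⟧⁻ pair? b∈
    ... | inj₁ refl | inj₁ refl = ⊥-elim (a≢b refl)
    ... | inj₁ refl | inj₂ refl = proj₂ uv
    ... | inj₂ refl | inj₁ refl = proj₂ (stronglyAnti-sym uv)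
    ... | inj₂ refl | inj₂ refl = ⊥-elim (a≢b refl)
    u∈ = ∈⟦⟧⁺ pair? (inj₁ refl)
    disconnected = closed⇒¬connected T
                     (isolated⇒closed T λ z uz z∈ → minus1⇒¬adj (stable _ z u∈ z∈ (proj₁ uz)) uz) refl u∈ (∈⟦⟧⁺ pair? (inj₂ refl)) (≢-sym (proj₁ uv))
    onlyNeighbour : ∀ z → Adj (complement T) s z → z ∉ ∁ ⟦ pair? ⟧
    onlyNeighbour z sz z∈ =
      plus1⇒¬anti (dominating z (λ e → ∈∁⟦⟧⁻ pair? z∈ (inj₁ e)) (λ e → ∈∁⟦⟧⁻ pair? z∈ (inj₂ e)) (≢-sym (proj₁ sz)))
                  (adjᶜ⇒anti sz)
    notAnticonnected = closed⇒¬connected (complement T) (isolated⇒closed (complement T) onlyNeighbour)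
                         refl (outside s≢u s≢v) (outside t≢u t≢v) t≢s

  noNeighbourInD⇒bsp : ∀ {m d} → StrongClique (λ w → ¬ InD T w) → ¬ InD T m → (∀ z → InD T z → ¬ Adj T m z)
    → InD T d → AtLeastTwo (λ w → ¬ InD T w × w ≢ m) → HasBalancedSkewPartition T
  noNeighbourInD⇒bsp {m} {d} clique ¬Dm noNeighbour Dd (p , q , p≢q , (¬Dp , p≢m) , (¬Dq , q≢m)) =
    strongCliqueCutset⇒bsp X? clique′ (p , q , p≢q , outside ¬Dp p≢m , outside ¬Dq q≢m)
      (isolated⇒closed T isolated) refl (inj₂ refl) (inj₁ Dd) (λ d≡m → ¬Dm (subst (InD T) d≡m Dd))
    where
    X? : Decidable (λ w → InD T w ⊎ w ≡ m)
    X? w = inD? w ⊎-dec (w ≟ m)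
    outside : ∀ {w} → ¬ InD T w → w ≢ m → ¬ (InD T w ⊎ w ≡ m)
    outside ¬Dw _ (inj₁ Dw) = ¬Dw Dw
    outside _ w≢m (inj₂ e) = w≢m e
    clique′ : StrongClique (λ w → ¬ (InD T w ⊎ w ≡ m))
    clique′ u v ¬Xu ¬Xv = clique u v (λ Du → ¬Xu (inj₁ Du)) (λ Dv → ¬Xv (inj₁ Dv))
    isolated : ∀ z → Adj T m z → ¬ (InD T z ⊎ z ≡ m)
    isolated z mz (inj₁ Dz) = noNeighbour z Dz mz
    isolated z mz (inj₂ e) = proj₁ mz (≡.sym e)

  noStrongAntiPair⇒strongClique : ¬ (∃₂ λ u v → StronglyAnti T u v × ¬ InD T u × ¬ InD T v)
    → StrongClique (λ w → ¬ InD T w)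
  noStrongAntiPair⇒strongClique noPair u v ¬Du ¬Dv u≢v with θ T u v in uv
  ... | plus1  = refl
  ... | zero0  = ⊥-elim (¬Du (v , u≢v , uv))
  ... | minus1 = ⊥-elim (noPair (u , v , (u≢v , uv) , ¬Du , ¬Dv))

module Holes {n : ℕ} (T : Trigraph n) where

  cycConsec? : ∀ k (i j : Fin k) → Dec (CycConsec T k i j)
  cycConsec? k i j = (toℕ j ℕ.≟ suc (toℕ i)) ⊎-dec ((toℕ i ℕ.≟ 0) ×-dec (suc (toℕ j) ℕ.≟ k))

  Edge : Bool → Fin n → Fin n → Set
  Edge true  = Adj T
  Edge false = Anti T

  edge⇒≢ : ∀ b {u v} → Edge b u v → u ≢ v
  edge⇒≢ true  = proj₁
  edge⇒≢ false = proj₁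

  HoleRel : ∀ {k} → (Fin k → Fin n) → Fin k → Fin k → Set
  HoleRel {k} h i j = Edge (does (cycConsec? k i j)) (h i) (h j)

  hole-intro : ∀ {k} (h : Fin k → Fin n) → 5 ≤ k → (∀ i j → toℕ i < toℕ j → HoleRel h i j) → IsHole T k h
  hole-intro {k} h 5≤k rel = 5≤k , injective , adjacent , antiadjacent
    where
    distinct : ∀ i j → toℕ i < toℕ j → h i ≢ h j
    distinct i j i<j = edge⇒≢ (does (cycConsec? k i j)) (rel i j i<j)
    injective : Injective _≡_ _≡_ h
    injective {i} {j} hi≡hj with <-cmp i j
    ... | tri< i<j _ _ = ⊥-elim (distinct i j i<j hi≡hj)
    ... | tri≈ _ i≡j _ = i≡j
    ... | tri> _ _ j<i = ⊥-elim (distinct j i j<i (≡.sym hi≡hj))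
    adjacent : ∀ i j → toℕ i < toℕ j → CycConsec T k i j → Adj T (h i) (h j)
    adjacent i j i<j c = subst (λ b → Edge b (h i) (h j)) (dec-true (cycConsec? k i j) c) (rel i j i<j)
    antiadjacent : ∀ i j → toℕ i < toℕ j → ¬ CycConsec T k i j → Anti T (h i) (h j)
    antiadjacent i j i<j ¬c = subst (λ b → Edge b (h i) (h j)) (dec-false (cycConsec? k i j) ¬c) (rel i j i<j)

  hole5 : ∀ {v₀ v₁ v₂ v₃ v₄}
    → Adj T v₀ v₁ → Anti T v₀ v₂ → Anti T v₀ v₃ → Adj T v₀ v₄
    → Adj T v₁ v₂ → Anti T v₁ v₃ → Anti T v₁ v₄
    → Adj T v₂ v₃ → Anti T v₂ v₄
    → Adj T v₃ v₄
    → IsHole T 5 (lookup (v₀ ∷ v₁ ∷ v₂ ∷ v₃ ∷ v₄ ∷ []))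
  hole5 {v₀} {v₁} {v₂} {v₃} {v₄} a01 a02 a03 a04 a12 a13 a14 a23 a24 a34 =
    hole-intro _ (s≤s (s≤s (s≤s (s≤s (s≤s z≤n))))) rel
    where
    rel : ∀ (i j : Fin 5) → toℕ i < toℕ j → HoleRel (lookup (v₀ ∷ v₁ ∷ v₂ ∷ v₃ ∷ v₄ ∷ [])) i j
    rel zero (suc zero) _ = a01
    rel (suc _) (suc zero) (s≤s ())
    rel zero (suc (suc zero)) _ = a02
    rel (suc zero) (suc (suc zero)) _ = a12
    rel (suc (suc _)) (suc (suc zero)) (s≤s (s≤s ()))
    rel zero (suc (suc (suc zero))) _ = a03
    rel (suc zero) (suc (suc (suc zero))) _ = a13
    rel (suc (suc zero)) (suc (suc (suc zero))) _ = a23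
    rel (suc (suc (suc _))) (suc (suc (suc zero))) (s≤s (s≤s (s≤s ())))
    rel zero (suc (suc (suc (suc zero)))) _ = a04
    rel (suc zero) (suc (suc (suc (suc zero)))) _ = a14
    rel (suc (suc zero)) (suc (suc (suc (suc zero)))) _ = a24
    rel (suc (suc (suc zero))) (suc (suc (suc (suc zero)))) _ = a34
    rel (suc (suc (suc (suc _)))) (suc (suc (suc (suc zero)))) (s≤s (s≤s (s≤s (s≤s ()))))

  hole6 : ∀ {v₀ v₁ v₂ v₃ v₄ v₅}
    → Adj T v₀ v₁ → Anti T v₀ v₂ → Anti T v₀ v₃ → Anti T v₀ v₄ → Adj T v₀ v₅
    → Adj T v₁ v₂ → Anti T v₁ v₃ → Anti T v₁ v₄ → Anti T v₁ v₅
    → Adj T v₂ v₃ → Anti T v₂ v₄ → Anti T v₂ v₅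
    → Adj T v₃ v₄ → Anti T v₃ v₅
    → Adj T v₄ v₅
    → IsHole T 6 (lookup (v₀ ∷ v₁ ∷ v₂ ∷ v₃ ∷ v₄ ∷ v₅ ∷ []))
  hole6 {v₀} {v₁} {v₂} {v₃} {v₄} {v₅} a01 a02 a03 a04 a05 a12 a13 a14 a15 a23 a24 a25 a34 a35 a45 =
    hole-intro _ (s≤s (s≤s (s≤s (s≤s (s≤s z≤n))))) rel
    where
    rel : ∀ (i j : Fin 6) → toℕ i < toℕ j → HoleRel (lookup (v₀ ∷ v₁ ∷ v₂ ∷ v₃ ∷ v₄ ∷ v₅ ∷ [])) i j
    rel zero (suc zero) _ = a01
    rel (suc _) (suc zero) (s≤s ())
    rel zero (suc (suc zero)) _ = a02
    rel (suc zero) (suc (suc zero)) _ = a12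
    rel (suc (suc _)) (suc (suc zero)) (s≤s (s≤s ()))
    rel zero (suc (suc (suc zero))) _ = a03
    rel (suc zero) (suc (suc (suc zero))) _ = a13
    rel (suc (suc zero)) (suc (suc (suc zero))) _ = a23
    rel (suc (suc (suc _))) (suc (suc (suc zero))) (s≤s (s≤s (s≤s ())))
    rel zero (suc (suc (suc (suc zero)))) _ = a04
    rel (suc zero) (suc (suc (suc (suc zero)))) _ = a14
    rel (suc (suc zero)) (suc (suc (suc (suc zero)))) _ = a24
    rel (suc (suc (suc zero))) (suc (suc (suc (suc zero)))) _ = a34
    rel (suc (suc (suc (suc _)))) (suc (suc (suc (suc zero)))) (s≤s (s≤s (s≤s (s≤s ()))))
    rel zero (suc (suc (suc (suc (suc zero))))) _ = a05
    rel (suc zero) (suc (suc (suc (suc (suc zero))))) _ = a15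
    rel (suc (suc zero)) (suc (suc (suc (suc (suc zero))))) _ = a25
    rel (suc (suc (suc zero))) (suc (suc (suc (suc (suc zero))))) _ = a35
    rel (suc (suc (suc (suc zero)))) (suc (suc (suc (suc (suc zero))))) _ = a45
    rel (suc (suc (suc (suc (suc _))))) (suc (suc (suc (suc (suc zero))))) (s≤s (s≤s (s≤s (s≤s (s≤s ())))))

  berge⇒¬hole5 : Berge T → ∀ {h} → ¬ IsHole T 5 h
  berge⇒¬hole5 (noOddHole , _) {h} hole = noOddHole (5 , h , (2 , refl) , hole)

module _ {n : ℕ} (T : Trigraph n) where

  open Adjacency T

  antihole6 : ∀ {v₀ v₁ v₂ v₃ v₄ v₅}
    → Anti T v₀ v₁ → Adj T v₀ v₂ → Adj T v₀ v₃ → Adj T v₀ v₄ → Anti T v₀ v₅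
    → Anti T v₁ v₂ → Adj T v₁ v₃ → Adj T v₁ v₄ → Adj T v₁ v₅
    → Anti T v₂ v₃ → Adj T v₂ v₄ → Adj T v₂ v₅
    → Anti T v₃ v₄ → Adj T v₃ v₅
    → Anti T v₄ v₅
    → IsAntihole T 6 (lookup (v₀ ∷ v₁ ∷ v₂ ∷ v₃ ∷ v₄ ∷ v₅ ∷ []))
  antihole6 a01 a02 a03 a04 a05 a12 a13 a14 a15 a23 a24 a25 a34 a35 a45 =
    Holes.hole6 (complement T)
      (anti⇒adjᶜ a01) (adj⇒antiᶜ a02) (adj⇒antiᶜ a03) (adj⇒antiᶜ a04) (anti⇒adjᶜ a05)
      (anti⇒adjᶜ a12) (adj⇒antiᶜ a13) (adj⇒antiᶜ a14) (adj⇒antiᶜ a15)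
      (anti⇒adjᶜ a23) (adj⇒antiᶜ a24) (adj⇒antiᶜ a25)
      (anti⇒adjᶜ a34) (adj⇒antiᶜ a35)
      (anti⇒adjᶜ a45)

module SmallComponent {n : ℕ} (T : Trigraph n) (x y : Fin n) (small : SmallComp T x y) where

  open Adjacency T
  open SkewPartitions T

  private variable w : Fin n

  x≢y : x ≢ y
  x≢y = proj₁ (proj₁ small)

  x∈D : InD T x
  x∈D = y , proj₁ small

  y∈D : InD T y
  y∈D = x , semi-sym (proj₁ small)

  inD⇒x⊎y : InD T w → w ≡ x ⊎ w ≡ y
  inD⇒x⊎y (u , wu) with proj₁ (proj₂ small) _ u wu
  ... | inj₁ (w≡x , _) = inj₁ w≡x
  ... | inj₂ (w≡y , _) = inj₂ w≡y

  ¬inD : w ≢ x → w ≢ y → ¬ InD T w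
  ¬inD w≢x w≢y Dw with inD⇒x⊎y Dw
  ... | inj₁ w≡x = w≢x w≡x
  ... | inj₂ w≡y = w≢y w≡y

  ≢x : ¬ InD T w → w ≢ x
  ≢x = ¬inD⇒≢ x∈D

  ≢y : ¬ InD T w → w ≢ y
  ≢y = ¬inD⇒≢ y∈D

  x≢ : ¬ InD T w → x ≢ w
  x≢ = ≢-sym ∘ ≢x

  y≢ : ¬ InD T w → y ≢ w
  y≢ = ≢-sym ∘ ≢y

  adj-xy : Adj T x y
  adj-xy = semi⇒adj (proj₁ small)

  disjoint : Adj T x w → ¬ Adj T y w
  disjoint xw yw = proj₂ (proj₂ small) _ (xw , yw)

  swapped : SmallComp T y x
  swapped = semi-sym (proj₁ small) , only , λ w (yw , xw) → disjoint xw yw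
    where
    only : OnlySwitchable1 T y x
    only u v uv with proj₁ (proj₂ small) u v uv
    ... | inj₁ e = inj₂ e
    ... | inj₂ e = inj₁ e

  twoNeighboursOfX⇒bsp : StrongClique (λ w → ¬ InD T w) → AtLeastTwo (λ w → ¬ InD T w × Adj T x w)
    → HasBalancedSkewPartition T
  twoNeighboursOfX⇒bsp clique (a , a′ , a≢a′ , (¬Da , xa) , (¬Da′ , xa′)) =
    strongAntiPair⇒bsp (¬adj⇒stronglyAnti (y≢ ¬Da) (disjoint xa))
      (≢y ¬Da′) (≢-sym a≢a′) x≢y (x≢ ¬Da) (x≢ ¬Da′)
      dominating
    where
    dominating : ∀ z → z ≢ y → z ≢ a → z ≢ a′ → θ T a′ z ≡ plus1
    dominating z z≢y _ z≢a′ with z ≟ x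
    ... | yes refl = adj∧¬inD⇒strong ¬Da′ (adj-sym xa′)
    ... | no z≢x = clique a′ z ¬Da′ (¬inD z≢x z≢y) (≢-sym z≢a′)

module SmallCliqueSides {n : ℕ} {T : Trigraph n}
  (berge : Berge T) (noBSP : ¬ HasBalancedSkewPartition T) (noC6 : ¬ ContainsAntihole6 T)
  (x y : Fin n) (small : SmallComp T x y)
  (cliqueX : Adjacency.NonNeighboursClique T x) (cliqueY : Adjacency.NonNeighboursClique T y)
  {a₀ b₀ : Fin n} (¬Da₀ : ¬ InD T a₀) (xa₀ : Adj T x a₀) (¬Db₀ : ¬ InD T b₀) (yb₀ : Adj T y b₀)
  (¬a₀b₀ : ¬ Adj T a₀ b₀) where

  open Adjacency T
  open SkewPartitions T
  open Connectivity T using (isolated⇒closed)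
  open Holes T using (hole5; berge⇒¬hole5)
  open SmallComponent T x y small

  NX NY : Fin n → Set
  NX w = ¬ InD T w × Adj T x w
  NY w = ¬ InD T w × Adj T y w

  NX-clique : ∀ {u v} → NX u → NX v → u ≢ v → θ T u v ≡ plus1
  NX-clique (¬Du , xu) (¬Dv , xv) u≢v =
    adj∧¬inD⇒strong ¬Du (cliqueY _ _ (¬Du , disjoint xu) (¬Dv , disjoint xv) u≢v)

  -- a vertex m in neither closes the 5-hole x a₀ m b₀ y
  outside⊆NX⊎NY : ∀ {m} → ¬ InD T m → NX m ⊎ NY m
  outside⊆NX⊎NY {m} ¬Dm with adj? x m | adj? y m
  ... | yes xm | _ = inj₁ (¬Dm , xm)
  ... | no _ | yes ym = inj₂ (¬Dm , ym)
  ... | no ¬xm | no ¬ym = ⊥-elim (berge⇒¬hole5 berge (hole5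
        xa₀ (¬adj⇒anti (x≢ ¬Dm) ¬xm) (¬adj⇒anti (x≢ ¬Db₀) ¬xb₀) adj-xy
        (cliqueY _ _ (¬Da₀ , disjoint xa₀) (¬Dm , ¬ym) a₀≢m) (¬adj⇒anti a₀≢b₀ ¬a₀b₀)
          (¬adj⇒anti (≢y ¬Da₀) (disjoint xa₀ ∘ adj-sym))
        (cliqueX _ _ (¬Dm , ¬xm) (¬Db₀ , ¬xb₀) m≢b₀) (¬adj⇒anti (≢y ¬Dm) (¬ym ∘ adj-sym))
        (adj-sym yb₀)))
    where
    ¬xb₀ : ¬ Adj T x b₀
    ¬xb₀ xb₀ = disjoint xb₀ yb₀
    a₀≢m : a₀ ≢ m
    a₀≢m refl = ¬xm xa₀
    m≢b₀ : m ≢ b₀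
    m≢b₀ refl = ¬ym yb₀
    a₀≢b₀ : a₀ ≢ b₀
    a₀≢b₀ refl = disjoint xa₀ yb₀

  -- otherwise the strong clique {x} ∪ NX ∖ {a} separates a from y
  anticompleteToNY⇒unique : ∀ {a} → NX a → (∀ b → NY b → ¬ Adj T a b) → ∀ {a′} → NX a′ → a′ ≡ a
  anticompleteToNY⇒unique {a} (¬Da , xa) anticomplete {a′} (¬Da′ , xa′) with a′ ≟ a
  ... | yes a′≡a = a′≡a
  ... | no a′≢a = ⊥-elim (noBSP (strongCliqueCutset⇒bsp (λ w → ¬? (clique? w)) clique
          (x , a′ , x≢ ¬Da′ , (λ ¬K → ¬K (inj₁ refl)) , (λ ¬K → ¬K (inj₂ ((¬Da′ , xa′) , a′≢a))))
          (isolated⇒closed isolated) refl a∉K y∉K (y≢ ¬Da)))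
    where
    K : Fin n → Set
    K w = w ≡ x ⊎ (NX w × w ≢ a)
    clique? : Decidable K
    clique? w = (w ≟ x) ⊎-dec (((¬? (inD? w)) ×-dec adj? x w) ×-dec ¬? (w ≟ a))
    strongInK : ∀ {u v} → K u → K v → u ≢ v → θ T u v ≡ plus1
    strongInK (inj₁ refl) (inj₁ refl) u≢v = ⊥-elim (u≢v refl)
    strongInK (inj₁ refl) (inj₂ ((¬Dv , xv) , _)) _ = adj∧¬inD⇒strong′ ¬Dv xv
    strongInK (inj₂ ((¬Du , xu) , _)) (inj₁ refl) _ = adj∧¬inD⇒strong ¬Du (adj-sym xu)
    strongInK (inj₂ (Xu , _)) (inj₂ (Xv , _)) u≢v = NX-clique Xu Xv u≢v
    clique : StrongClique (λ w → ¬ ¬ K w)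
    clique u v ¬¬Ku ¬¬Kv = strongInK (decidable-stable (clique? u) ¬¬Ku) (decidable-stable (clique? v) ¬¬Kv)
    a∉K : ¬ K a
    a∉K (inj₁ refl) = ¬Da x∈D
    a∉K (inj₂ (_ , a≢a)) = a≢a refl
    y∉K : ¬ K y
    y∉K (inj₁ y≡x) = x≢y (≡.sym y≡x)
    y∉K (inj₂ ((¬Dy , _) , _)) = ¬Dy y∈D
    isolated : ∀ z → Adj T a z → ¬ ¬ K z
    isolated z az ¬Kz with inD? z
    ... | yes Dz with inD⇒x⊎y Dz
    ...   | inj₁ refl = ¬Kz (inj₁ refl)
    ...   | inj₂ refl = disjoint xa (adj-sym az)
    isolated z az ¬Kz | no ¬Dz with outside⊆NX⊎NY ¬Dz
    ...   | inj₁ Xz = ¬Kz (inj₂ (Xz , ≢-sym (proj₁ az)))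
    ...   | inj₂ Yz = anticomplete z Yz az

  -- otherwise a is strongly complete to everything but the strongly stable pair {y, a′}
  completeToNY⇒unique : ∀ {a} → NX a → (∀ b → NY b → Adj T a b) → ∀ {a′} → NX a′ → a′ ≡ a
  completeToNY⇒unique {a} (¬Da , xa) complete {a′} (¬Da′ , xa′) with a′ ≟ a
  ... | yes a′≡a = a′≡a
  ... | no a′≢a = ⊥-elim (noBSP (strongAntiPair⇒bsp
          (¬adj⇒stronglyAnti (y≢ ¬Da′) (disjoint xa′))
          (≢y ¬Da) (≢-sym a′≢a) x≢y (x≢ ¬Da′) (x≢ ¬Da)
          dominating))
    where
    dominating : ∀ z → z ≢ y → z ≢ a′ → z ≢ a → θ T a z ≡ plus1
    dominating z z≢y _ z≢a with z ≟ x
    ... | yes refl = adj∧¬inD⇒strong ¬Da (adj-sym xa)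
    ... | no z≢x with outside⊆NX⊎NY (¬inD z≢x z≢y)
    ...   | inj₁ Xz = NX-clique (¬Da , xa) Xz (≢-sym z≢a)
    ...   | inj₂ Yz = adj∧¬inD⇒strong ¬Da (complete z Yz)

  ¬completeToNY : ∀ {a} → NX a → ¬ (∀ b → NY b → Adj T a b)
  ¬completeToNY Xa complete =
    ¬a₀b₀ (subst (λ v → Adj T v b₀) (≡.sym (completeToNY⇒unique Xa complete (¬Da₀ , xa₀))) (complete b₀ (¬Db₀ , yb₀)))

  -- x b₁ a₂ y a₁ b₂ would be an antihole
  noCrossing : ∀ {a₁ a₂ b₁ b₂} → NX a₁ → NX a₂ → NY b₁ → NY b₂
    → Adj T a₁ b₁ → Adj T a₂ b₂ → ¬ Adj T a₂ b₁ → ¬ Adj T a₁ b₂ → ⊥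
  noCrossing {a₁} {a₂} {b₁} {b₂} (¬Da₁ , xa₁) (¬Da₂ , xa₂) (¬Db₁ , yb₁) (¬Db₂ , yb₂)
             a₁b₁ a₂b₂ ¬a₂b₁ ¬a₁b₂ =
    noC6 (_ , antihole6 T
      (¬adj⇒anti (x≢ ¬Db₁) ¬xb₁) xa₂ adj-xy xa₁
        (¬adj⇒anti (x≢ ¬Db₂) ¬xb₂)
      (¬adj⇒anti b₁≢a₂ (¬a₂b₁ ∘ adj-sym)) (adj-sym yb₁) (adj-sym a₁b₁)
        (cliqueX _ _ (¬Db₁ , ¬xb₁) (¬Db₂ , ¬xb₂) b₁≢b₂)
      (¬adj⇒anti (≢y ¬Da₂) (disjoint xa₂ ∘ adj-sym))
        (cliqueY _ _ (¬Da₂ , disjoint xa₂) (¬Da₁ , disjoint xa₁) a₂≢a₁) a₂b₂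
      (¬adj⇒anti (y≢ ¬Da₁) (disjoint xa₁)) yb₂
      (¬adj⇒anti a₁≢b₂ ¬a₁b₂))
    where
    ¬xb₁ : ¬ Adj T x b₁
    ¬xb₁ xb₁ = disjoint xb₁ yb₁
    ¬xb₂ : ¬ Adj T x b₂
    ¬xb₂ xb₂ = disjoint xb₂ yb₂
    b₁≢a₂ : b₁ ≢ a₂
    b₁≢a₂ refl = disjoint xa₂ yb₁
    b₁≢b₂ : b₁ ≢ b₂
    b₁≢b₂ refl = ¬a₁b₂ a₁b₁
    a₂≢a₁ : a₂ ≢ a₁
    a₂≢a₁ refl = ¬a₁b₂ a₂b₂
    a₁≢b₂ : a₁ ≢ b₂
    a₁≢b₂ refl = disjoint xa₁ yb₂

  _⊑_ : Fin n → Fin n → Set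
  a ⊑ a′ = ∀ b → NY b → Adj T a b → Adj T a′ b

  ⊑-refl : Reflexive _⊑_
  ⊑-refl _ _ ab = ab

  ⊑-trans : Transitive _⊑_
  ⊑-trans a⊑b b⊑c c Yc ac = b⊑c c Yc (a⊑b c Yc ac)

  ⊑-total : ∀ {a a′} → NX a → NX a′ → ¬ ¬ (a ⊑ a′ ⊎ a′ ⊑ a)
  ⊑-total {a} {a′} Xa Xa′ k = ¬¬-excluded-middle λ
    { (yes a⊑a′) → k (inj₁ a⊑a′)
    ; (no a⋢a′) → k (inj₂ λ b₁ Yb₁ a′b₁ → decidable-stable (adj? a b₁) λ ¬ab₁ →
        a⋢a′ λ b₂ Yb₂ ab₂ → decidable-stable (adj? a′ b₂) λ ¬a′b₂ →
          noCrossing Xa Xa′ Yb₂ Yb₁ ab₂ a′b₁ ¬a′b₂ ¬ab₁) }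

  -- a ⊑-minimal s has no neighbour b in NY, since b would then be complete to NX
  NX-singleton : (∀ b → NY b → ¬ (∀ a → NX a → Adj T a b)) → ¬ ¬ (∃ λ s → ∀ {a} → NX a → a ≡ s)
  NX-singleton ¬completeToNX k =
    ¬¬-minimum ⊑-refl ⊑-trans ⊑-total (allFin n) (¬Da₀ , xa₀)
      λ (s , Xs , minimal) → k (s , anticompleteToNY⇒unique Xs λ b Yb sb →
        ¬completeToNX b Yb λ a Xa → minimal (∈-allFin a) Xa b Yb sb)

module _ {n : ℕ} (T : Trigraph n) (x y : Fin n) (small : SmallComp T x y) where

  open Adjacency T
  open SkewPartitions T
  open SmallComponent T x y small

  smallComp∧strongClique⇒bsp : 5 < n → StrongClique (λ w → ¬ InD T w) → HasBalancedSkewPartition T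
  smallComp∧strongClique⇒bsp 5<n clique = cases (triple-classify triple (λ {w} _ → adjacentTo x y w))
    where
    triple : Triple (λ w → ¬ InD T w)
    triple = triple-avoiding 5<n x y y (λ w≢x w≢y _ → ¬inD w≢x w≢y)
    cases : TripleOutcome (λ w → ¬ InD T w) (Adj T x) (Adj T y) (λ w → ¬ Adj T x w × ¬ Adj T y w)
          → HasBalancedSkewPartition T
    cases (inj₁ (m , ¬Dm , (¬xm , ¬ym) , others)) = noNeighbourInD⇒bsp clique ¬Dm noNeighbour x∈D others
      where
      noNeighbour : ∀ z → InD T z → ¬ Adj T m z
      noNeighbour z Dz mz with inD⇒x⊎y Dz
      ... | inj₁ refl = ¬xm (adj-sym mz)
      ... | inj₂ refl = ¬ym (adj-sym mz)
    cases (inj₂ (inj₁ twoX)) = twoNeighboursOfX⇒bsp clique twoX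
    cases (inj₂ (inj₂ twoY)) = SmallComponent.twoNeighboursOfX⇒bsp T y x swapped clique twoY

  smallCliqueSides⇒⊥ : Berge T → ¬ HasBalancedSkewPartition T → ¬ ContainsAntihole6 T → 5 < n
    → NonNeighboursClique x → NonNeighboursClique y
    → ∀ {a₀ b₀} → ¬ InD T a₀ → Adj T x a₀ → ¬ InD T b₀ → Adj T y b₀ → ¬ Adj T a₀ b₀ → ⊥
  smallCliqueSides⇒⊥ berge noBSP noC6 5<n cliqueX cliqueY ¬Da₀ xa₀ ¬Db₀ yb₀ ¬a₀b₀ =
    X.NX-singleton (λ b Yb complete → Y.¬completeToNY Yb λ a Xa → adj-sym (complete a Xa)) λ (s , onlyS) →
    Y.NX-singleton (λ a Xa complete → X.¬completeToNY Xa λ b Yb → adj-sym (complete b Yb)) λ (t , onlyT) →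
    cases onlyS onlyT (triple-classify triple λ ¬Dw → map₂ inj₁ (X.outside⊆NX⊎NY ¬Dw))
    where
    module X = SmallCliqueSides berge noBSP noC6 x y small cliqueX cliqueY ¬Da₀ xa₀ ¬Db₀ yb₀ ¬a₀b₀
    module Y = SmallCliqueSides berge noBSP noC6 y x swapped cliqueY cliqueX ¬Db₀ yb₀ ¬Da₀ xa₀ (¬a₀b₀ ∘ adj-sym)
    triple : Triple (λ w → ¬ InD T w)
    triple = triple-avoiding 5<n x y y (λ w≢x w≢y _ → ¬inD w≢x w≢y)
    cases : ∀ {s t} → (∀ {a} → X.NX a → a ≡ s) → (∀ {b} → X.NY b → b ≡ t)
      → TripleOutcome (λ w → ¬ InD T w) X.NX X.NY (λ _ → ⊥) → ⊥
    cases _ _ (inj₁ (_ , _ , () , _))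
    cases onlyS _ (inj₂ (inj₁ twoX)) = ¬atLeastTwo (onlyS ∘ proj₂) twoX
    cases _ onlyT (inj₂ (inj₂ twoY)) = ¬atLeastTwo (onlyT ∘ proj₂) twoY

  unfavorable⇒nonNeighboursCliques : Unfavorable T → 5 ≤ n
    → (∃₂ λ u v → StronglyAnti T u v × ¬ InD T u × ¬ InD T v)
    → ¬ ¬ (NonNeighboursClique x × NonNeighboursClique y)
  unfavorable⇒nonNeighboursCliques unfavorable 5≤n pair k = ¬¬-excluded-middle λ
    { (no ¬cX) → unfavorable (5≤n , pair , condition3 (inj₁ ¬cX))
    ; (yes cX) → ¬¬-excluded-middle λ
        { (no ¬cY) → unfavorable (5≤n , pair , condition3 (inj₂ ¬cY))
        ; (yes cY) → k (cX , cY) } }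
    where
    condition3 : ¬ NonNeighboursClique x ⊎ ¬ NonNeighboursClique y
      → ∀ x′ y′ → SmallComp T x′ y′ → ¬ NonNeighboursClique x′ ⊎ ¬ NonNeighboursClique y′
    condition3 ¬c x′ y′ small′ with proj₁ (proj₂ small) x′ y′ (proj₁ small′)
    ... | inj₁ (refl , refl) = ¬c
    ... | inj₂ (refl , refl) = swap ¬c

  separatedBySides : NonNeighboursClique x → NonNeighboursClique y
    → ∀ {u v} → StronglyAnti T u v → ¬ InD T u → ¬ InD T v
    → ∃₂ λ a b → ¬ InD T a × Adj T x a × ¬ InD T b × Adj T y b × ¬ Adj T a b
  separatedBySides cX cY {u} {v} uv ¬Du ¬Dv with adj? x u | adj? x v | adj? y u | adj? y v
  ... | yes xu | _ | _ | yes yv = u , v , ¬Du , xu , ¬Dv , yv , stronglyAnti⇒¬adj uv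
  ... | _ | yes xv | yes yu | _ = v , u , ¬Dv , xv , ¬Du , yu , stronglyAnti⇒¬adj (stronglyAnti-sym uv)
  ... | no ¬xu | no ¬xv | _ | _ = ⊥-elim (stronglyAnti⇒¬adj uv (cX u v (¬Du , ¬xu) (¬Dv , ¬xv) (proj₁ uv)))
  ... | _ | _ | no ¬yu | no ¬yv = ⊥-elim (stronglyAnti⇒¬adj uv (cY u v (¬Du , ¬yu) (¬Dv , ¬yv) (proj₁ uv)))
  ... | yes xu | _ | yes yu | _ = ⊥-elim (disjoint xu yu)
  ... | _ | yes xv | _ | yes yv = ⊥-elim (disjoint xv yv)

  smallCase⇒⊥ : Berge T → ¬ HasBalancedSkewPartition T → ¬ ContainsAntihole6 T → 5 < n → Unfavorable T → ⊥
  smallCase⇒⊥ berge noBSP noC6 5<n unfavorable = ¬¬-excluded-middle λ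
    { (no noPair) → noBSP (smallComp∧strongClique⇒bsp 5<n (noStrongAntiPair⇒strongClique noPair))
    ; (yes pair@(_ , _ , uv , ¬Du , ¬Dv)) →
        unfavorable⇒nonNeighboursCliques unfavorable (<⇒≤ 5<n) pair λ (cX , cY) →
        let (_ , _ , ¬Da , xa , ¬Db , yb , ¬ab) = separatedBySides cX cY uv ¬Du ¬Dv
        in smallCliqueSides⇒⊥ berge noBSP noC6 5<n cX cY ¬Da xa ¬Db yb ¬ab }

module LightComponent {n : ℕ} (T : Trigraph n) (c x y : Fin n) (light : LightComp T c x y) where

  open Adjacency T
  open SkewPartitions T
  open Connectivity T using (AdjClosedIn)
  open Holes T using (hole5; berge⇒¬hole5)

  private variable w : Fin n

  cx : Semi T c x
  cx = proj₁ light

  cy : Semi T c y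
  cy = proj₁ (proj₂ light)

  only : OnlySwitchable2 T c x y
  only = proj₁ (proj₂ (proj₂ (proj₂ light)))

  c-anticomplete : ∀ w → w ≢ c → w ≢ x → w ≢ y → StronglyAnti T c w
  c-anticomplete = proj₁ (proj₂ (proj₂ (proj₂ (proj₂ light))))

  xy : StronglyAnti T x y
  xy = proj₁ (proj₂ (proj₂ (proj₂ (proj₂ (proj₂ light)))))

  commonNeighbour : ∀ w → Adj T x w × Adj T y w → w ≡ c
  commonNeighbour = proj₂ (proj₂ (proj₂ (proj₂ (proj₂ (proj₂ light)))))

  c∈D : InD T c
  c∈D = x , cx

  x∈D : InD T x
  x∈D = c , semi-sym cx

  y∈D : InD T y
  y∈D = c , semi-sym cy

  inD⇒c⊎x⊎y : InD T w → w ≡ c ⊎ w ≡ x ⊎ w ≡ y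
  inD⇒c⊎x⊎y (u , wu) with only _ u wu
  ... | inj₁ (w≡c , _) = inj₁ w≡c
  ... | inj₂ (inj₁ (w≡x , _)) = inj₂ (inj₁ w≡x)
  ... | inj₂ (inj₂ (inj₁ (w≡c , _))) = inj₁ w≡c
  ... | inj₂ (inj₂ (inj₂ (w≡y , _))) = inj₂ (inj₂ w≡y)

  ≢c : ¬ InD T w → w ≢ c
  ≢c = ¬inD⇒≢ c∈D

  ≢x : ¬ InD T w → w ≢ x
  ≢x = ¬inD⇒≢ x∈D

  ≢y : ¬ InD T w → w ≢ y
  ≢y = ¬inD⇒≢ y∈D

  c≢ : ¬ InD T w → c ≢ w
  c≢ = ≢-sym ∘ ≢c

  x≢ : ¬ InD T w → x ≢ w
  x≢ = ≢-sym ∘ ≢x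

  ¬inD : w ≢ c → w ≢ x → w ≢ y → ¬ InD T w
  ¬inD w≢c w≢x w≢y Dw with inD⇒c⊎x⊎y Dw
  ... | inj₁ w≡c = w≢c w≡c
  ... | inj₂ (inj₁ w≡x) = w≢x w≡x
  ... | inj₂ (inj₂ w≡y) = w≢y w≡y

  c-anti : ¬ InD T w → StronglyAnti T c w
  c-anti ¬Dw = c-anticomplete _ (≢c ¬Dw) (≢x ¬Dw) (≢y ¬Dw)

  ¬commonNeighbour : ¬ InD T w → Adj T x w → ¬ Adj T y w
  ¬commonNeighbour ¬Dw xw yw = ¬Dw (subst (InD T) (≡.sym (commonNeighbour _ (xw , yw))) c∈D)

  ¬smallComp : ∀ {x′ y′} → ¬ SmallComp T x′ y′
  ¬smallComp (x′y′ , only′ , _) with only′ c x cx | only′ c y cy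
  ... | inj₁ (_ , x≡y′) | inj₁ (_ , y≡y′) = proj₁ xy (≡.trans x≡y′ (≡.sym y≡y′))
  ... | inj₁ (c≡x′ , _) | inj₂ (c≡y′ , _) = proj₁ x′y′ (≡.trans (≡.sym c≡x′) c≡y′)
  ... | inj₂ (c≡y′ , _) | inj₁ (c≡x′ , _) = proj₁ x′y′ (≡.trans (≡.sym c≡x′) c≡y′)
  ... | inj₂ (_ , x≡x′) | inj₂ (_ , y≡x′) = proj₁ xy (≡.trans x≡x′ (≡.sym y≡x′))

  swapped : LightComp T c y x
  swapped = cy , cx , ≢-sym (proj₁ xy) , only′ , (λ w w≢c w≢y w≢x → c-anticomplete w w≢c w≢x w≢y)
          , stronglyAnti-sym xy , λ w (yw , xw) → commonNeighbour w (xw , yw)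
    where
    only′ : OnlySwitchable2 T c y x
    only′ u v uv with only u v uv
    ... | inj₁ e = inj₂ (inj₂ (inj₁ e))
    ... | inj₂ (inj₁ e) = inj₂ (inj₂ (inj₂ e))
    ... | inj₂ (inj₂ (inj₁ e)) = inj₁ e
    ... | inj₂ (inj₂ (inj₂ e)) = inj₂ (inj₁ e)

  module _ (clique : StrongClique (λ w → ¬ InD T w)) where

    neighboursOfXAndY⇒hole : ∀ {a b} → ¬ InD T a → Adj T x a → ¬ InD T b → Adj T y b
      → IsHole T 5 (lookup (c ∷ x ∷ a ∷ b ∷ y ∷ []))
    neighboursOfXAndY⇒hole {a} {b} ¬Da xa ¬Db yb = hole5
      (semi⇒adj cx) (stronglyAnti⇒anti (c-anti ¬Da)) (stronglyAnti⇒anti (c-anti ¬Db)) (semi⇒adj cy)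
      xa (¬adj⇒anti (x≢ ¬Db) (λ xb → ¬commonNeighbour ¬Db xb yb)) (stronglyAnti⇒anti xy)
      (strong⇒adj a≢b (clique a b ¬Da ¬Db a≢b)) (¬adj⇒anti (≢y ¬Da) (¬commonNeighbour ¬Da xa ∘ adj-sym))
      (adj-sym yb)
      where
      a≢b : a ≢ b
      a≢b refl = ¬commonNeighbour ¬Da xa yb

    -- the strong clique {x, a} separates {c, y} from a′
    onlyXHasNeighbours⇒bsp : ∀ {a a′} → ¬ InD T a → Adj T x a → ¬ InD T a′ → a′ ≢ a
      → (∀ b → ¬ InD T b → ¬ Adj T y b) → HasBalancedSkewPartition T
    onlyXHasNeighbours⇒bsp {a} {a′} ¬Da xa ¬Da′ a′≢a ¬Y =
      strongCliqueCutset⇒bsp X? edge (x , a , x≢ ¬Da , (λ X → proj₁ X refl) , (λ X → proj₂ X refl))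
        closed (inj₁ refl) (proj₁ cx , c≢ ¬Da)
        (≢x ¬Da′ , a′≢a) [ ≢c ¬Da′ , ≢y ¬Da′ ]
      where
      X? : Decidable (λ w → w ≢ x × w ≢ a)
      X? w = ¬? (w ≟ x) ×-dec ¬? (w ≟ a)
      xa-strong : θ T x a ≡ plus1
      xa-strong = adj∧¬inD⇒strong′ ¬Da xa
      edgeEnd : ∀ {w} → ¬ (w ≢ x × w ≢ a) → w ≡ x ⊎ w ≡ a
      edgeEnd {w} ¬X with w ≟ x | w ≟ a
      ... | yes w≡x | _ = inj₁ w≡x
      ... | no _ | yes w≡a = inj₂ w≡a
      ... | no w≢x | no w≢a = ⊥-elim (¬X (w≢x , w≢a))
      edge : StrongClique (λ w → ¬ (w ≢ x × w ≢ a))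
      edge u v ¬Xu ¬Xv u≢v with edgeEnd ¬Xu | edgeEnd ¬Xv
      ... | inj₁ refl | inj₁ refl = ⊥-elim (u≢v refl)
      ... | inj₁ refl | inj₂ refl = xa-strong
      ... | inj₂ refl | inj₁ refl = ≡.trans (sym T a x) xa-strong
      ... | inj₂ refl | inj₂ refl = ⊥-elim (u≢v refl)
      closed : AdjClosedIn (λ w → w ≢ x × w ≢ a) (λ w → w ≡ c ⊎ w ≡ y)
      closed {w} {z} Sw wz Xz with inD? z
      ... | yes Dz with inD⇒c⊎x⊎y Dz
      ...   | inj₁ z≡c = inj₁ z≡c
      ...   | inj₂ (inj₁ z≡x) = ⊥-elim (proj₁ Xz z≡x)
      ...   | inj₂ (inj₂ z≡y) = inj₂ z≡y
      closed (inj₁ refl) cz Xz | no ¬Dz = ⊥-elim (stronglyAnti⇒¬adj (c-anti ¬Dz) cz)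
      closed (inj₂ refl) yz Xz | no ¬Dz = ⊥-elim (¬Y _ ¬Dz yz)

    twoNeighboursOfX⇒bsp : Berge T → AtLeastTwo (λ w → ¬ InD T w × Adj T x w) → HasBalancedSkewPartition T
    twoNeighboursOfX⇒bsp berge (a , a′ , a≢a′ , (¬Da , xa) , (¬Da′ , _))
      with any? (λ b → ¬? (inD? b) ×-dec adj? y b)
    ... | yes (b , ¬Db , yb) = ⊥-elim (berge⇒¬hole5 berge (neighboursOfXAndY⇒hole ¬Da xa ¬Db yb))
    ... | no none = onlyXHasNeighbours⇒bsp ¬Da xa ¬Da′ (≢-sym a≢a′) λ b ¬Db yb → none (b , ¬Db , yb)

module _ {n : ℕ} (T : Trigraph n) (c x y : Fin n) (light : LightComp T c x y) where

  open Adjacency T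
  open SkewPartitions T
  open LightComponent T c x y light

  lightComp∧strongClique⇒bsp : Berge T → 5 < n → StrongClique (λ w → ¬ InD T w) → HasBalancedSkewPartition T
  lightComp∧strongClique⇒bsp berge 5<n clique = cases (triple-classify triple (λ {w} _ → adjacentTo x y w))
    where
    triple : Triple (λ w → ¬ InD T w)
    triple = triple-avoiding 5<n c x y ¬inD
    cases : TripleOutcome (λ w → ¬ InD T w) (Adj T x) (Adj T y) (λ w → ¬ Adj T x w × ¬ Adj T y w)
          → HasBalancedSkewPartition T
    cases (inj₁ (m , ¬Dm , (¬xm , ¬ym) , others)) = noNeighbourInD⇒bsp clique ¬Dm noNeighbour c∈D others
      where
      noNeighbour : ∀ z → InD T z → ¬ Adj T m z
      noNeighbour z Dz mz with inD⇒c⊎x⊎y Dz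
      ... | inj₁ refl = stronglyAnti⇒¬adj (c-anti ¬Dm) (adj-sym mz)
      ... | inj₂ (inj₁ refl) = ¬xm (adj-sym mz)
      ... | inj₂ (inj₂ refl) = ¬ym (adj-sym mz)
    cases (inj₂ (inj₁ twoX)) = twoNeighboursOfX⇒bsp clique berge twoX
    cases (inj₂ (inj₂ twoY)) = LightComponent.twoNeighboursOfX⇒bsp T c y x swapped clique berge twoY

unfavorable⇒noStrongAntiPair : ∀ {n} {T : Trigraph n} → InF T → ¬ HasBalancedSkewPartition T
  → ¬ ContainsAntihole6 T → 5 < n → Unfavorable T → ∀ u v → ¬ StronglyAnti T u v
unfavorable⇒noStrongAntiPair (_ , inj₁ noSwitchable) _ _ 5<n unfavorable u v uv =
  unfavorable (<⇒≤ 5<n , (u , v , uv , (λ (_ , uw) → noSwitchable _ _ uw) , (λ (_ , vw) → noSwitchable _ _ vw))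
              , λ _ _ small → ⊥-elim (noSwitchable _ _ (proj₁ small)))
unfavorable⇒noStrongAntiPair {T = T} (berge , inj₂ (inj₁ (x , y , small))) noBSP noC6 5<n unfavorable _ _ _ =
  smallCase⇒⊥ T x y small berge noBSP noC6 5<n unfavorable
unfavorable⇒noStrongAntiPair {T = T} (berge , inj₂ (inj₂ (c , x , y , light))) noBSP _ 5<n unfavorable _ _ _ =
  noBSP (lightComp∧strongClique⇒bsp T c x y light berge 5<n
    (SkewPartitions.noStrongAntiPair⇒strongClique T λ pair →
      unfavorable (<⇒≤ 5<n , pair , λ _ _ small → ⊥-elim (LightComponent.¬smallComp T c x y light small))))

theorem3p3 : ∀ {n : ℕ} (T : Trigraph n) → InF T
    → ¬ HasBalancedSkewPartition T → ¬ ContainsAntihole6 T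
    → Unfavorable T → Complete T ⊎ n ≤ 5
theorem3p3 {n} T inF noBSP noC6 unfavorable with n ≤? 5
... | yes n≤5 = inj₂ n≤5
... | no n≰5 = inj₁ (Adjacency.noStrongAntiPair⇒complete T
                      (unfavorable⇒noStrongAntiPair inF noBSP noC6 (≰⇒> n≰5) unfavorable))
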